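{- If $Q_n$ is the hypercube of order $n$ ($n$ a positive integer), then $\mathrm{rc}(Q_n)=n-1$.
   Context: $Q_n$ has as vertices all binary strings of length $n$, two being adjacent iff they differ in exactly one position. Cop and robber game with radius of capture $k$: first the cop chooses a vertex, then the robber; afterwards, starting with the cop, the players alternately either move to an adjacent vertex or stay put, both knowing both positions. The cop wins if at some point the distance between the players is at most $k$. $\mathcal{CWRC}(k)$ is the class of graphs on which the cop has a winning strategy. $\mathrm{rc}(G)=\min\{k\in\mathbb{N}_0 \mid G\in\mathcal{CWRC}(k)\}$. -}

module Defs where

open import Level using (Level; _⊔_) renaming (suc to lsuc)
open import Data.Nat using (ℕ; zero; suc; _≤_)
open import Data.Bool using (Bool)
open import Data.Fin using (Fin)
open import Data.Vec using (Vec; lookup)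
open import Data.Product using (Σ; ∃; _×_; _,_)
open import Data.Sum using (_⊎_)
open import Relation.Binary.PropositionalEquality using (_≡_)
open import Relation.Nullary using (¬_)

module Game {a ℓ : Level} (V : Set a) (Adj : V → V → Set ℓ) where

  data Move (u : V) : V → Set (a ⊔ ℓ) where
    stay : Move u u
    go   : ∀ {v} → Adj u v → Move u v

  data Within : ℕ → V → V → Set (a ⊔ ℓ) where
    here : ∀ {k u} → Within k u u
    step : ∀ {k u v w} → Adj u v → Within k v w → Within (suc k) u w

  -- CopWins k c r : in the position where the cop is at c, the robber at r,
  -- and it is the cop's turn, the cop has a strategy forcing that at some
  -- point the distance between the players is at most k
  -- (inductive = well-founded game tree, i.e. capture in finitely many steps).
  data CopWins (k : ℕ) (c r : V) : Set (a ⊔ ℓ) where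
    caught : Within k c r → CopWins k c r
    play   : (c' : V) → Move c c' →
             (Within k c' r ⊎ (∀ r' → Move r r' → CopWins k c' r')) →
             CopWins k c r

  -- G ∈ CWRC(k): the cop chooses a vertex, then the robber chooses a vertex,
  -- then the cop moves first.
  CWRC : ℕ → Set (a ⊔ ℓ)
  CWRC k = Σ V λ c → ∀ r → CopWins k c r

  rcIs : ℕ → Set (a ⊔ ℓ)
  rcIs m = CWRC m × (∀ k → CWRC k → m ≤ k)

QVertex : ℕ → Set
QVertex n = Vec Bool n

QAdj : (n : ℕ) → QVertex n → QVertex n → Set
QAdj n u v = Σ (Fin n) λ i →
  (¬ lookup u i ≡ lookup v i) × (∀ j → ¬ j ≡ i → lookup u j ≡ lookup v j)

rcQ-is : (n m : ℕ) → Set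
rcQ-is n m = Game.rcIs (QVertex n) (QAdj n) m

{-# OPTIONS --safe #-}
-- The robber escapes every radius k < n − 1 by always standing at the
-- antipode of the cop: complementing every bit is an automorphism of Q_n, so
-- this answer to any cop move is legal, and a cop move of length ≤ 1 ending
-- within k of the antipode of its start gives n = hamming c (antipode c) ≤ k + 1.
-- The cop wins with radius n − 1 from any vertex by first copying the robber's
-- first bit: afterwards the two differ in at most the other n − 1 bits.
module Submission where

open import Defs
open import Data.Nat using (ℕ; suc; _≤_; _∸_; _+_; z≤n; s≤s; s≤s⁻¹)
open import Data.Nat.Properties using (≤-trans; ≤-reflexive; +-monoˡ-≤; +-monoʳ-≤; +-suc)
open import Data.Bool using (true; false; not; _xor_; if_then_else_)
open import Data.Bool.Properties using (_≟_; xor-same; not-injective)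
open import Data.Fin using (zero; suc)
open import Data.Fin.Properties using (suc-injective)
open import Data.Vec using ([]; _∷_; lookup; map; replicate)
open import Data.Vec.Properties using (lookup-map)
open import Data.Vec.Relation.Binary.Pointwise.Extensional using (ext; Pointwise-≡⇒≡)
open import Data.Product using (∃-syntax; _,_)
open import Data.Sum using (inj₁; inj₂)
open import Function using (_∘_)
open import Level using (Level)
open import Relation.Binary.PropositionalEquality using (_≡_; _≢_; refl; cong; trans; sym)
open import Relation.Nullary using (yes; no; contradiction)

module GameProperties {a ℓ : Level} (V : Set a) (Adj : V → V → Set ℓ) where
  open Game V Adj

  Within-suc : ∀ {k u v} → Within k u v → Within (suc k) u v
  Within-suc here       = here
  Within-suc (step e w) = step e (Within-suc w)

  Move-Within : ∀ {k u v w} → Move u v → Within k v w → Within (suc k) u w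
  Move-Within stay   w = Within-suc w
  Move-Within (go e) w = step e w

  module Mirror (σ : V → V) (σ-adj : ∀ u v → Adj u v → Adj (σ u) (σ v)) where

    σ-move : ∀ {u v} → Move u v → Move (σ u) (σ v)
    σ-move         stay   = stay
    σ-move {u} {v} (go e) = go (σ-adj u v e)

    -- The robber answers every cop move c → c' with σ c'.
    CopWins-mirror⇒Within : ∀ {k c} → CopWins k c (σ c) →
                            ∃[ c' ] Within (suc k) c' (σ c')
    CopWins-mirror⇒Within {c = c} (caught w)           = c , Within-suc w
    CopWins-mirror⇒Within {c = c} (play _ m (inj₁ w))  = c , Move-Within m w
    CopWins-mirror⇒Within (play c' m (inj₂ continue)) =
      CopWins-mirror⇒Within (continue (σ c') (σ-move m))

module Q {n : ℕ} = Game (QVertex n) (QAdj n)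
open Q
module QProperties {n : ℕ} = GameProperties (QVertex n) (QAdj n)
open QProperties

private
  variable
    n k : ℕ

∷-adj : ∀ b {u v : QVertex n} → QAdj n u v → QAdj (suc n) (b ∷ u) (b ∷ v)
∷-adj b (i , differs , agrees) = suc i , differs , agrees′
  where
  agrees′ : ∀ j → j ≢ suc i → lookup (b ∷ _) j ≡ lookup (b ∷ _) j
  agrees′ zero    _     = refl
  agrees′ (suc j) j≢1+i = agrees j (j≢1+i ∘ cong suc)

∷-Within : ∀ b {u v : QVertex n} → Within k u v → Within k (b ∷ u) (b ∷ v)
∷-Within b here       = here
∷-Within b (step e w) = step (∷-adj b e) (∷-Within b w)

head-Move : ∀ x y (xs : QVertex n) → Move (x ∷ xs) (y ∷ xs)
head-Move x y xs with x ≟ y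
... | yes refl = stay
... | no  x≢y  = go (zero , x≢y , agrees)
  where
  agrees : ∀ j → j ≢ zero → lookup (x ∷ xs) j ≡ lookup (y ∷ xs) j
  agrees zero    j≢0 = contradiction refl j≢0
  agrees (suc j) _   = refl

Within-diameter : (u v : QVertex n) → Within n u v
Within-diameter []       []       = here
Within-diameter (x ∷ xs) (y ∷ ys) =
  Move-Within (head-Move x y xs) (∷-Within y (Within-diameter xs ys))

Q-CopWins : (c r : QVertex (suc n)) → CopWins n c r
Q-CopWins (x ∷ xs) (y ∷ ys) =
  play (y ∷ xs) (head-Move x y xs) (inj₁ (∷-Within y (Within-diameter xs ys)))

antipode : QVertex n → QVertex n
antipode = map not

antipode-adj : (u v : QVertex n) → QAdj n u v → QAdj n (antipode u) (antipode v)
antipode-adj u v (i , differs , agrees) =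
  i , differs′ , agrees′
  where
  differs′ : lookup (antipode u) i ≢ lookup (antipode v) i
  differs′ eq = differs (not-injective
    (trans (sym (lookup-map i not u)) (trans eq (lookup-map i not v))))
  agrees′ : ∀ j → j ≢ i → lookup (antipode u) j ≡ lookup (antipode v) j
  agrees′ j j≢i =
    trans (lookup-map j not u) (trans (cong not (agrees j j≢i)) (sym (lookup-map j not v)))

hamming : QVertex n → QVertex n → ℕ
hamming []       []       = 0
hamming (x ∷ xs) (y ∷ ys) = (if x xor y then 1 else 0) + hamming xs ys

hamming-self : (u : QVertex n) → hamming u u ≡ 0
hamming-self []       = refl
hamming-self (x ∷ xs) rewrite xor-same x = hamming-self xs

hamming-antipode : (u : QVertex n) → hamming u (antipode u) ≡ n
hamming-antipode []           = refl
hamming-antipode (true  ∷ xs) = cong suc (hamming-antipode xs)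
hamming-antipode (false ∷ xs) = cong suc (hamming-antipode xs)

QAdj⇒hamming≤suc : (u v w : QVertex n) → QAdj n u v → hamming u w ≤ suc (hamming v w)
QAdj⇒hamming≤suc (x ∷ xs) (y ∷ ys) (z ∷ zs) (zero , _ , agrees)
  rewrite Pointwise-≡⇒≡ {xs = xs} {ys} (ext λ j → agrees (suc j) λ ()) =
  +-monoˡ-≤ (hamming ys zs) (bit≤suc (x xor z))
  where
  bit≤suc : ∀ b → (if b then 1 else 0) ≤ suc (if y xor z then 1 else 0)
  bit≤suc true  = s≤s z≤n
  bit≤suc false = z≤n
QAdj⇒hamming≤suc (x ∷ xs) (y ∷ ys) (z ∷ zs) (suc i , differs , agrees)
  with refl ← agrees zero (λ ()) =
  ≤-trans (+-monoʳ-≤ bit (QAdj⇒hamming≤suc xs ys zs tails-adj))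
          (≤-reflexive (+-suc bit (hamming ys zs)))
  where
  bit : ℕ
  bit = if x xor z then 1 else 0
  tails-adj : QAdj _ xs ys
  tails-adj = i , differs , λ j j≢i → agrees (suc j) (j≢i ∘ suc-injective)

Within⇒hamming≤ : ∀ {u v : QVertex n} → Within k u v → hamming u v ≤ k
Within⇒hamming≤ {u = u} here = ≤-trans (≤-reflexive (hamming-self u)) z≤n
Within⇒hamming≤ {u = u} {v} (step {v = m} e w) =
  ≤-trans (QAdj⇒hamming≤suc u m v e) (s≤s (Within⇒hamming≤ w))

CWRC⇒≤suc : CWRC {n} k → n ≤ suc k
CWRC⇒≤suc (c , wins) with CopWins-mirror⇒Within (wins (antipode c))
  where open Mirror antipode antipode-adj
... | c' , w = ≤-trans (≤-reflexive (sym (hamming-antipode c'))) (Within⇒hamming≤ w)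

corollary5p6 : (n : ℕ) → 1 ≤ n → rcQ-is n (n ∸ 1)
corollary5p6 (suc n) _ =
  (replicate (suc n) false , Q-CopWins _) , λ k cwrc → s≤s⁻¹ (CWRC⇒≤suc cwrc)
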